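{- For every $n\geq 1$, the directed friendship graph $F_n$ admits a strong SA$(2n+2,1)$AL, i.e. a strong total labeling whose subtractive arc-weights are exactly $2n+2,2n+3,\ldots,5n+1$.
   Context: The directed friendship graph $F_n$ has vertices $x$ and $v_{i1},v_{i2}$ ($1\le i\le n$), and arcs $xv_{i1}$, $v_{i1}v_{i2}$, $v_{i2}x$ for $1\le i\le n$ ($n$ directed triangles sharing the vertex $x$). For a digraph $G=(V,A)$, a total labeling is a bijection $\lambda:V\cup A\to\{1,2,\ldots,|V|+|A|\}$. For an arc $yz$ (tail $y$, head $z$), $wt^-(yz)=\lambda(yz)+\lambda(z)-\lambda(y)$. An SA$(a,d)$AL is a total labeling whose set of arc-weights is $\{a,a+d,\ldots,a+(|A|-1)d\}$ (all distinct). A total labeling is strong if $\lambda(V)=\{1,\ldots,|V|\}$. -}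

module Defs where

open import Data.Nat using (ℕ; _+_; _*_; _<_; _≤_)
import Data.Nat as ℕ
open import Data.Fin using (Fin; toℕ; zero; suc)
open import Data.Sum using (_⊎_; inj₁; inj₂)
open import Data.Product using (Σ; ∃; _×_; _,_)
open import Data.Integer using (ℤ; +_) renaming (_+_ to _+ℤ_; _-_ to _-ℤ_; _*_ to _*ℤ_)
open import Function.Bundles using (_⤖_; Bijection)
open import Function.Definitions using (Injective)
open import Relation.Binary.PropositionalEquality using (_≡_)

-- Vertices of the directed friendship graph F_n:
-- the centre x, and v i j  (i : Fin n, j : Fin 2) standing for v_{i,j+1}.
data Vertex (n : ℕ) : Set where
  x : Vertex n
  v : Fin n → Fin 2 → Vertex n

data Arc (n : ℕ) : Set where
  arc₁ arc₂ arc₃ : Fin n → Arc n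

tail : ∀ {n} → Arc n → Vertex n
tail (arc₁ i) = x
tail (arc₂ i) = v i zero
tail (arc₃ i) = v i (suc zero)

head : ∀ {n} → Arc n → Vertex n
head (arc₁ i) = v i zero
head (arc₂ i) = v i (suc zero)
head (arc₃ i) = x

|V| : ℕ → ℕ
|V| n = 1 + 2 * n

|A| : ℕ → ℕ
|A| n = 3 * n

Element : ℕ → Set
Element n = Vertex n ⊎ Arc n

-- A total labeling: a bijection V ∪ A → {1,…,|V|+|A|}, represented as a
-- bijection onto Fin (|V|+|A|), the label being 1 + toℕ of the image.
TotalLabeling : ℕ → Set
TotalLabeling n = Element n ⤖ Fin (|V| n + |A| n)

module _ {n : ℕ} (λ′ : TotalLabeling n) where
  open Bijection λ′ using (to)

  label : Element n → ℕ
  label e = ℕ.suc (toℕ (to e))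

  labelV : Vertex n → ℕ
  labelV y = label (inj₁ y)

  labelA : Arc n → ℕ
  labelA a = label (inj₂ a)

  wt⁻ : Arc n → ℤ
  wt⁻ a = (+ labelA a +ℤ + labelV (head a)) -ℤ + labelV (tail a)

  IsStrong : Set
  IsStrong = ((y : Vertex n) → (1 ≤ labelV y) × (labelV y ≤ |V| n)) ×
             ((k : ℕ) → 1 ≤ k → k ≤ |V| n → Σ (Vertex n) λ y → labelV y ≡ k)

  IsSAAL : ℤ → ℤ → Set
  IsSAAL a d =
    Injective _≡_ _≡_ wt⁻ ×
    ((e : Arc n) → Σ ℕ λ k → (k < |A| n) × (wt⁻ e ≡ a +ℤ (+ k) *ℤ d)) ×
    ((k : ℕ) → k < |A| n → Σ (Arc n) λ e → wt⁻ e ≡ a +ℤ (+ k) *ℤ d)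

-- Label x by 1, v_{i1} by i + 2, v_{i2} by 2n + 1 − i, and the arcs x v_{i1}, v_{i1} v_{i2},
-- v_{i2} x by 2n + 2 + i, 3n + 2 + i and 4n + 2 + i (for 0 ≤ i < n). The vertices get
-- 1, …, 2n + 1, and the arc weights are 2n + 2 plus 2i + 1, 2n + (n − 1 − i) and 2i
-- respectively: the two outer arcs of the triangles interleave on 0, …, 2n − 1 and the
-- middle arcs fill 2n, …, 3n − 1. Both the labeling and this enumeration of the weights
-- are assembled from the block bijections Fin (a + b) ≅ Fin a ⊎ Fin b and
-- Fin (a · b) ≅ Fin a × Fin b, so bijectivity never has to be checked by hand.
module Submission where

open import Defs
open import Data.Nat using (ℕ; _≥_; _+_; _*_)
open import Data.Product using (Σ; _×_)
open import Data.Integer using (+_)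

open import Data.Nat using (suc; _∸_; _<_; _≤_; s≤s; z≤n)
open import Data.Nat.Properties
  using (+-cancelˡ-≡; +-cancelʳ-≡; +-identityʳ; *-zeroʳ; *-identityʳ; *-comm; m≤m+n; m+n∸m≡n; m∸n+n≡m)
open import Data.Nat.Tactic.RingSolver using (solve)
open import Data.List.Base using (_∷_; [])
open import Data.Fin using (Fin; toℕ; fromℕ<; opposite; cast; combine)
import Data.Fin as Fin
open import Data.Fin.Patterns using (0F; 1F; 2F)
open import Data.Fin.Properties
  using (toℕ-↑ˡ; toℕ-↑ʳ; toℕ-fromℕ<; toℕ-cast; toℕ-combine; toℕ<n; toℕ-injective;
         cast-involutive; opposite-involutive; opposite-prop; +↔⊎; *↔×)
open import Data.Sum using (_⊎_; inj₁; inj₂)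
open import Data.Sum.Function.Propositional using (_⊎-↔_)
open import Data.Product using (_,_)
import Data.Integer as ℤ
open import Data.Integer.Properties using (pos-+; [+m]-[+n]≡m⊖n; ⊖-≥; +-injective)
  renaming (*-identityʳ to ℤ*-identityʳ)
open import Function.Bundles using (_↔_; Inverse; mk↔ₛ′)
open import Function.Definitions using (Injective)
open import Function.Properties.Inverse using (↔-refl; ↔-sym; ↔-trans; ↔⇒⤖)
open import Relation.Binary.PropositionalEquality
  using (_≡_; refl; sym; trans; cong; cong₂; module ≡-Reasoning)

open Inverse using (to; from; strictlyInverseˡ; strictlyInverseʳ)

cast↔ : ∀ {m k} → m ≡ k → Fin m ↔ Fin k
cast↔ eq = mk↔ₛ′ (cast eq) (cast (sym eq)) (cast-involutive eq (sym eq)) (cast-involutive (sym eq) eq)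

toℕ-to-from-fromℕ< : ∀ {A : Set} {m k} (ι : A ↔ Fin m) (k<m : k < m) →
                      toℕ (to ι (from ι (fromℕ< k<m))) ≡ k
toℕ-to-from-fromℕ< ι k<m = trans (cong toℕ (strictlyInverseˡ ι _)) (toℕ-fromℕ< k<m)

[+p]+[+q]-[+r]≡+m : ∀ p q r {m} → p + q ≡ r + m → (+ p ℤ.+ + q) ℤ.- + r ≡ + m
[+p]+[+q]-[+r]≡+m p q r {m} p+q≡r+m = begin
  (+ p ℤ.+ + q) ℤ.- + r  ≡⟨ cong (ℤ._- + r) (sym (pos-+ p q)) ⟩
  + (p + q) ℤ.- + r      ≡⟨ [+m]-[+n]≡m⊖n (p + q) r ⟩
  (p + q) ℤ.⊖ r          ≡⟨ cong (ℤ._⊖ r) p+q≡r+m ⟩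
  (r + m) ℤ.⊖ r          ≡⟨ ⊖-≥ (m≤m+n r m) ⟩
  + (r + m ∸ r)          ≡⟨ cong +_ (m+n∸m≡n r m) ⟩
  + m                    ∎
  where open ≡-Reasoning

+c+[+k]*1≡+[c+k] : ∀ c k → + c ℤ.+ + k ℤ.* + 1 ≡ + (c + k)
+c+[+k]*1≡+[c+k] c k = trans (cong (λ t → + c ℤ.+ t) (ℤ*-identityʳ (+ k))) (sym (pos-+ c k))

wt⁻≡+ : ∀ {n} (lab : TotalLabeling n) a {w} →
        labelA lab a + labelV lab (head a) ≡ labelV lab (tail a) + w → wt⁻ lab a ≡ + w
wt⁻≡+ lab a = [+p]+[+q]-[+r]≡+m (labelA lab a) (labelV lab (head a)) (labelV lab (tail a))

module ShiftedIndex {A : Set} {m : ℕ} (w : A → ℤ.ℤ) (c : ℕ) (ι : A ↔ Fin m)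
                    (w≡c+ι : ∀ a → w a ≡ + (c + toℕ (to ι a))) where

  injective : Injective _≡_ _≡_ w
  injective {a} {b} wa≡wb = begin
    a                ≡⟨ sym (strictlyInverseʳ ι a) ⟩
    from ι (to ι a)  ≡⟨ cong (from ι) (toℕ-injective ιa≡ιb) ⟩
    from ι (to ι b)  ≡⟨ strictlyInverseʳ ι b ⟩
    b                ∎
    where
    open ≡-Reasoning
    ιa≡ιb : toℕ (to ι a) ≡ toℕ (to ι b)
    ιa≡ιb = +-cancelˡ-≡ c _ _ (+-injective (trans (sym (w≡c+ι a)) (trans wa≡wb (w≡c+ι b))))

  inProgression : ∀ a → Σ ℕ λ k → k < m × w a ≡ + c ℤ.+ + k ℤ.* + 1
  inProgression a = toℕ (to ι a) , toℕ<n (to ι a) ,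
    trans (w≡c+ι a) (sym (+c+[+k]*1≡+[c+k] c _))

  attainsProgression : ∀ k → k < m → Σ A λ a → w a ≡ + c ℤ.+ + k ℤ.* + 1
  attainsProgression k k<m = from ι (fromℕ< k<m) , (begin
    w (from ι (fromℕ< k<m))                  ≡⟨ w≡c+ι _ ⟩
    + (c + toℕ (to ι (from ι (fromℕ< k<m)))) ≡⟨ cong (λ j → + (c + j)) (toℕ-to-from-fromℕ< ι k<m) ⟩
    + (c + k)                                ≡⟨ sym (+c+[+k]*1≡+[c+k] c k) ⟩
    + c ℤ.+ + k ℤ.* + 1                      ∎)
    where open ≡-Reasoning

module VerticesFirst {n : ℕ} (vertexIndex : Vertex n ↔ Fin (|V| n)) (arcIndex : Arc n ↔ Fin (|A| n)) where

  labeling : TotalLabeling n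
  labeling = ↔⇒⤖ (↔-trans (vertexIndex ⊎-↔ arcIndex) (↔-sym +↔⊎))

  labelV-labeling : ∀ y → labelV labeling y ≡ suc (toℕ (to vertexIndex y))
  labelV-labeling y = cong suc (toℕ-↑ˡ (to vertexIndex y) (|A| n))

  labelA-labeling : ∀ a → labelA labeling a ≡ suc (|V| n + toℕ (to arcIndex a))
  labelA-labeling a = cong suc (toℕ-↑ʳ (|V| n) (to arcIndex a))

  labeling-isStrong : IsStrong labeling
  labeling-isStrong = bounded , onto
    where
    bounded : ∀ y → 1 ≤ labelV labeling y × labelV labeling y ≤ |V| n
    bounded y rewrite labelV-labeling y = s≤s z≤n , toℕ<n (to vertexIndex y)
    onto : ∀ k → 1 ≤ k → k ≤ |V| n → Σ (Vertex n) λ y → labelV labeling y ≡ k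
    onto (suc k) _ k<|V| = from vertexIndex (fromℕ< k<|V|) ,
      trans (labelV-labeling _) (cong suc (toℕ-to-from-fromℕ< vertexIndex k<|V|))

module FriendshipLabeling (n : ℕ) where

  vertexBlocks : Vertex n ↔ (Fin 1 ⊎ (Fin 2 × Fin n))
  vertexBlocks = mk↔ₛ′ toBlock fromBlock toFrom fromTo
    where
    toBlock : Vertex n → Fin 1 ⊎ (Fin 2 × Fin n)
    toBlock x = inj₁ 0F
    toBlock (v i 0F) = inj₂ (0F , i)
    toBlock (v i 1F) = inj₂ (1F , opposite i)
    fromBlock : Fin 1 ⊎ (Fin 2 × Fin n) → Vertex n
    fromBlock (inj₁ 0F) = x
    fromBlock (inj₂ (0F , i)) = v i 0F
    fromBlock (inj₂ (1F , i)) = v (opposite i) 1F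
    toFrom : ∀ b → toBlock (fromBlock b) ≡ b
    toFrom (inj₁ 0F) = refl
    toFrom (inj₂ (0F , i)) = refl
    toFrom (inj₂ (1F , i)) = cong (λ j → inj₂ (1F , j)) (opposite-involutive i)
    fromTo : ∀ y → fromBlock (toBlock y) ≡ y
    fromTo x = refl
    fromTo (v i 0F) = refl
    fromTo (v i 1F) = cong (λ j → v j 1F) (opposite-involutive i)

  arcBlocks : Arc n ↔ (Fin 3 × Fin n)
  arcBlocks = mk↔ₛ′ toBlock fromBlock toFrom fromTo
    where
    toBlock : Arc n → Fin 3 × Fin n
    toBlock (arc₁ i) = 0F , i
    toBlock (arc₂ i) = 1F , i
    toBlock (arc₃ i) = 2F , i
    fromBlock : Fin 3 × Fin n → Arc n
    fromBlock (0F , i) = arc₁ i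
    fromBlock (1F , i) = arc₂ i
    fromBlock (2F , i) = arc₃ i
    toFrom : ∀ b → toBlock (fromBlock b) ≡ b
    toFrom (0F , i) = refl
    toFrom (1F , i) = refl
    toFrom (2F , i) = refl
    fromTo : ∀ a → fromBlock (toBlock a) ≡ a
    fromTo (arc₁ i) = refl
    fromTo (arc₂ i) = refl
    fromTo (arc₃ i) = refl

  vertexIndex : Vertex n ↔ Fin (|V| n)
  vertexIndex = ↔-trans vertexBlocks (↔-trans (↔-refl ⊎-↔ ↔-sym *↔×) (↔-sym +↔⊎))

  arcIndex : Arc n ↔ Fin (|A| n)
  arcIndex = ↔-trans arcBlocks (↔-sym *↔×)

  open VerticesFirst vertexIndex arcIndex public

  vertexLabel : Vertex n → ℕ
  vertexLabel x = 1
  vertexLabel (v i 0F) = 2 + toℕ i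
  vertexLabel (v i 1F) = 2 + n + toℕ (opposite i)

  arcLabel : Arc n → ℕ
  arcLabel (arc₁ i) = 2 + 2 * n + toℕ i
  arcLabel (arc₂ i) = 2 + 2 * n + (n + toℕ i)
  arcLabel (arc₃ i) = 2 + 2 * n + (2 * n + toℕ i)

  labelV-inBlock : ∀ y (k : Fin 2) (i : Fin n) {c} → to vertexIndex y ≡ Fin.suc (combine k i) → n * toℕ k ≡ c →
            labelV labeling y ≡ 2 + (c + toℕ i)
  labelV-inBlock y k i eq nk≡c = trans (labelV-labeling y) (trans (cong (λ j → suc (toℕ j)) eq)
    (cong (λ t → 2 + t) (trans (toℕ-combine k i) (cong (_+ toℕ i) nk≡c))))

  labelA-inBlock : ∀ a (k : Fin 3) (i : Fin n) {c} → to arcIndex a ≡ combine k i → n * toℕ k ≡ c →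
            labelA labeling a ≡ 2 + 2 * n + (c + toℕ i)
  labelA-inBlock a k i eq nk≡c = trans (labelA-labeling a) (cong (λ t → suc (|V| n + t))
    (trans (cong toℕ eq) (trans (toℕ-combine k i) (cong (_+ toℕ i) nk≡c))))

  labelV≡vertexLabel : ∀ y → labelV labeling y ≡ vertexLabel y
  labelV≡vertexLabel x = labelV-labeling x
  labelV≡vertexLabel (v i 0F) = labelV-inBlock (v i 0F) 0F i refl (*-zeroʳ n)
  labelV≡vertexLabel (v i 1F) = labelV-inBlock (v i 1F) 1F (opposite i) refl (*-identityʳ n)

  labelA≡arcLabel : ∀ a → labelA labeling a ≡ arcLabel a
  labelA≡arcLabel (arc₁ i) = labelA-inBlock (arc₁ i) 0F i refl (*-zeroʳ n)
  labelA≡arcLabel (arc₂ i) = labelA-inBlock (arc₂ i) 1F i refl (*-identityʳ n)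
  labelA≡arcLabel (arc₃ i) = labelA-inBlock (arc₃ i) 2F i refl (*-comm n 2)

  weightBlocks : Arc n ↔ ((Fin n × Fin 2) ⊎ Fin n)
  weightBlocks = mk↔ₛ′ toBlock fromBlock toFrom fromTo
    where
    toBlock : Arc n → (Fin n × Fin 2) ⊎ Fin n
    toBlock (arc₁ i) = inj₁ (i , 1F)
    toBlock (arc₂ i) = inj₂ (opposite i)
    toBlock (arc₃ i) = inj₁ (i , 0F)
    fromBlock : (Fin n × Fin 2) ⊎ Fin n → Arc n
    fromBlock (inj₁ (i , 0F)) = arc₃ i
    fromBlock (inj₁ (i , 1F)) = arc₁ i
    fromBlock (inj₂ i) = arc₂ (opposite i)
    toFrom : ∀ b → toBlock (fromBlock b) ≡ b
    toFrom (inj₁ (i , 0F)) = refl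
    toFrom (inj₁ (i , 1F)) = refl
    toFrom (inj₂ i) = cong inj₂ (opposite-involutive i)
    fromTo : ∀ a → fromBlock (toBlock a) ≡ a
    fromTo (arc₁ i) = refl
    fromTo (arc₂ i) = cong arc₂ (opposite-involutive i)
    fromTo (arc₃ i) = refl

  weightIndex : Arc n ↔ Fin (|A| n)
  weightIndex = ↔-trans weightBlocks
    (↔-trans (↔-sym *↔× ⊎-↔ ↔-refl) (↔-trans (↔-sym +↔⊎) (cast↔ n*2+n≡3*n)))
    where
    n*2+n≡3*n : n * 2 + n ≡ 3 * n
    n*2+n≡3*n = solve (n ∷ [])

  weightOffset : Arc n → ℕ
  weightOffset (arc₁ i) = 2 * toℕ i + 1
  weightOffset (arc₂ i) = 2 * n + toℕ (opposite i)
  weightOffset (arc₃ i) = 2 * toℕ i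

  toℕ-weightIndex : ∀ a → toℕ (to weightIndex a) ≡ weightOffset a
  toℕ-weightIndex (arc₁ i) = trans (toℕ-cast _ _) (trans (toℕ-↑ˡ _ n) (toℕ-combine i 1F))
  toℕ-weightIndex (arc₂ i) = trans (toℕ-cast _ _) (trans (toℕ-↑ʳ (n * 2) _) (cong (_+ toℕ (opposite i)) (*-comm n 2)))
  toℕ-weightIndex (arc₃ i) = trans (toℕ-cast _ _) (trans (toℕ-↑ˡ _ n) (trans (toℕ-combine i 0F) (+-identityʳ _)))

  opposite+suc≡n : ∀ (i : Fin n) → toℕ (opposite i) + suc (toℕ i) ≡ n
  opposite+suc≡n i = trans (cong (_+ suc (toℕ i)) (opposite-prop i)) (m∸n+n≡m (toℕ<n i))

  arcLabel-balance : ∀ a → arcLabel a + vertexLabel (head a) ≡ vertexLabel (tail a) + (2 * n + 2 + weightOffset a)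
  arcLabel-balance (arc₁ i) with toℕ i
  ... | I = solve (n ∷ I ∷ [])
  arcLabel-balance (arc₂ i) with toℕ i | toℕ (opposite i)
  ... | I | O = solve (n ∷ I ∷ O ∷ [])
  arcLabel-balance (arc₃ i) with toℕ i | toℕ (opposite i) | opposite+suc≡n i
  ... | I | O | O+suc[I]≡n = +-cancelʳ-≡ n _ _ (begin
    2 + 2 * n + (2 * n + I) + 1 + n            ≡⟨ cong (λ t → 2 + 2 * n + (2 * n + I) + 1 + t) (sym O+suc[I]≡n) ⟩
    2 + 2 * n + (2 * n + I) + 1 + (O + suc I)  ≡⟨ solve (n ∷ I ∷ O ∷ []) ⟩
    2 + n + O + (2 * n + 2 + 2 * I) + n        ∎)
    where open ≡-Reasoning

  wt⁻≡2n+2+weightIndex : ∀ a → wt⁻ labeling a ≡ + (2 * n + 2 + toℕ (to weightIndex a))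
  wt⁻≡2n+2+weightIndex a = wt⁻≡+ labeling a (begin
    labelA labeling a + labelV labeling (head a)
      ≡⟨ cong₂ _+_ (labelA≡arcLabel a) (labelV≡vertexLabel (head a)) ⟩
    arcLabel a + vertexLabel (head a)
      ≡⟨ arcLabel-balance a ⟩
    vertexLabel (tail a) + (2 * n + 2 + weightOffset a)
      ≡⟨ cong₂ _+_ (sym (labelV≡vertexLabel (tail a)))
                   (cong (λ t → 2 * n + 2 + t) (sym (toℕ-weightIndex a))) ⟩
    labelV labeling (tail a) + (2 * n + 2 + toℕ (to weightIndex a)) ∎)
    where open ≡-Reasoning

mainTheorem13 : (n : ℕ) → n ≥ 1 →
    Σ (TotalLabeling n) λ lab →
      IsStrong lab × IsSAAL lab (+ (2 * n + 2)) (+ 1)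
mainTheorem13 n _ = labeling , labeling-isStrong , (injective , inProgression , attainsProgression)
  where
  open FriendshipLabeling n
  open ShiftedIndex (wt⁻ labeling) (2 * n + 2) weightIndex wt⁻≡2n+2+weightIndex
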